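{- Let $\mathcal{C}$ be a class of symbolic heaps and let $\mathfrak{A}$ and $\mathfrak{B}$ be heap automata over $\mathrm{SH}^{\mathcal{C}}$. Then there exist heap automata $\mathfrak{C}_1,\mathfrak{C}_2,\mathfrak{C}_3$ over $\mathrm{SH}^{\mathcal{C}}$ with $L(\mathfrak{C}_1)=L(\mathfrak{A})\cup L(\mathfrak{B})$, $L(\mathfrak{C}_2)=L(\mathfrak{A})\cap L(\mathfrak{B})$, and $L(\mathfrak{C}_3)=\mathrm{RSH}^{\mathcal{C}}\setminus L(\mathfrak{A})$.
   Context: Symbolic heaps. A symbolic heap has the form $\varphi = \exists \mathbf{z}.\ \Sigma * \Gamma : \Pi$, where $\Sigma$ is $\mathbf{emp}$ or a separating conjunction of points-to assertions, $\Gamma = P_1\mathbf{x}_1*\cdots*P_m\mathbf{x}_m$ is a separating conjunction of $m\ge0$ predicate calls, and $\Pi$ a finite set of pure formulas $x=y$, $x\ne y$; $|\Gamma^\varphi|=m$, and $\varphi$ is reduced if $m=0$. For a class $\mathcal{C}$ of symbolic heaps, $\mathrm{SH}^{\mathcal{C}}$ and $\mathrm{RSH}^{\mathcal{C}}$ are the symbolic heaps, resp. reduced symbolic heaps, in $\mathcal{C}$. Predicate replacement $\varphi[P_1/\tau_1,\ldots,P_m/\tau_m]$ substitutes $\tau_i$ (free variables renamed to the parameters of the $i$-th call, bound variables renamed apart and added to the existential prefix, spatial and pure parts merged) for the $i$-th predicate call. Heap automata. A heap automaton over $\mathrm{SH}^{\mathcal{C}}$ is $\mathfrak{A}=(Q,\mathrm{SH}^{\mathcal{C}},\Delta,F)$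 with finite state set $Q$, final states $F\subseteq Q$, and a decidable transition relation $\Delta\subseteq Q^*\times\mathrm{SH}^{\mathcal{C}}\times Q$ with $(\mathbf{q},\varphi,p)\in\Delta\Rightarrow|\mathbf{q}|=|\Gamma^\varphi|$, which is compositional: for all $p\in Q$, all $\varphi\in\mathrm{SH}^{\mathcal{C}}$ with $m$ predicate calls and all $\tau_1,\ldots,\tau_m\in\mathrm{RSH}^{\mathcal{C}}$: there is $\mathbf{q}\in Q^m$ with $(\mathbf{q},\varphi,p)\in\Delta$ and $(\varepsilon,\tau_i,\mathbf{q}[i])\in\Delta$ for all $i$ iff $(\varepsilon,\varphi[P_1/\tau_1,\ldots,P_m/\tau_m],p)\in\Delta$. The language is $L(\mathfrak{A})=\{\tau\in\mathrm{RSH}^{\mathcal{C}}:\exists q\in F.\ (\varepsilon,\tau,q)\in\Delta\}$. -}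

module Defs where

open import Data.Nat using (ℕ; _+_; _≟_)
open import Data.Fin using (Fin; _↑ˡ_; _↑ʳ_; splitAt; cast)
open import Data.Fin.Subset using (Subset; _∈_)
open import Data.List using (List; []; _∷_; _++_; length; lookup; map)
open import Data.List.Relation.Unary.All using (All)
open import Data.List.Relation.Binary.Pointwise using (Pointwise)
open import Data.Maybe using (Maybe; just; nothing)
open import Data.Product using (Σ; ∃; _×_; _,_)
open import Data.Sum using (_⊎_; inj₁; inj₂)
open import Relation.Nullary using (Dec; yes; no; ¬_)
open import Relation.Binary.PropositionalEquality using (_≡_)
open import Function.Bundles using (_⇔_)

-- Variables of a symbolic heap with n free variables (the parameters
-- x₁ … xₙ, in this order) and k existentially bound variables z₁ … z_k.
data Var (n k : ℕ) : Set where
  free  : Fin n → Var n k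
  bound : Fin k → Var n k

record PointsTo (V : Set) : Set where
  constructor _↦_
  field
    src  : V
    dsts : List V

record Call (V : Set) : Set where
  constructor call
  field
    pred : ℕ
    args : List V

data PureF (V : Set) : Set where
  _≐_ : V → V → PureF V
  _≉_ : V → V → PureF V

mapPointsTo : ∀ {V W : Set} → (V → W) → PointsTo V → PointsTo W
mapPointsTo f (x ↦ ys) = f x ↦ map f ys

mapCall : ∀ {V W : Set} → (V → W) → Call V → Call W
mapCall f (call P xs) = call P (map f xs)

mapPure : ∀ {V W : Set} → (V → W) → PureF V → PureF W
mapPure f (x ≐ y) = f x ≐ f y
mapPure f (x ≉ y) = f x ≉ f y

-- φ = ∃ z₁…z_nbv . Σ * Γ : Π   with free variables x₁ … x_nfv.
-- Σ = emp is the empty list of points-to assertions.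
record SH : Set where
  constructor mkSH
  field
    nfv     : ℕ
    nbv     : ℕ
    spatial : List (PointsTo (Var nfv nbv))
    calls   : List (Call (Var nfv nbv))
    pure    : List (PureF (Var nfv nbv))

open SH public

Reduced : SH → Set
Reduced φ = calls φ ≡ []

record Parts (V : Set) : Set where
  constructor parts
  field
    pSpatial : List (PointsTo V)
    pCalls   : List (Call V)
    pPure    : List (PureF V)

renParts : ∀ {V W : Set} → (V → W) → Parts V → Parts W
renParts f (parts s c p) =
  parts (map (mapPointsTo f) s) (map (mapCall f) c) (map (mapPure f) p)

_+++_ : ∀ {V : Set} → Parts V → Parts V → Parts V
parts s c p +++ parts s' c' p' = parts (s ++ s') (c ++ c') (p ++ p')

partsOf : (τ : SH) → Parts (Var (nfv τ) (nbv τ))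
partsOf τ = parts (spatial τ) (calls τ) (pure τ)

sumB : List SH → ℕ
sumB []       = 0
sumB (τ ∷ τs) = nbv τ + sumB τs

-- Free variable xⱼ of τᵢ becomes the j-th argument of the i-th call; the
-- bound variables of τᵢ become fresh bound variables (renamed apart) placed
-- after those of φ and of τ₁ … τᵢ₋₁.
replaceParts : ∀ {n k} → List (Call (Var n k)) → (τs : List SH)
             → Maybe (Parts (Var n (k + sumB τs)))
replaceParts []       []       = just (parts [] [] [])
replaceParts []       (_ ∷ _)  = nothing
replaceParts (_ ∷ _)  []       = nothing
replaceParts {n} {k} (call P xs ∷ cs) (τ ∷ τs) with nfv τ ≟ length xs
... | no _   = nothing
... | yes eq with replaceParts cs τs
...   | nothing   = nothing
...   | just rest = just (renParts σ (partsOf τ) +++ renParts liftTail rest)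
  where
    b = nbv τ
    B = sumB τs

    liftArg : Var n k → Var n (k + (b + B))
    liftArg (free x)  = free x
    liftArg (bound z) = bound (z ↑ˡ (b + B))

    σ : Var (nfv τ) (nbv τ) → Var n (k + (b + B))
    σ (free j)  = liftArg (lookup xs (cast eq j))
    σ (bound j) = bound (k ↑ʳ (j ↑ˡ B))

    liftTail : Var n (k + B) → Var n (k + (b + B))
    liftTail (free x) = free x
    liftTail (bound z) with splitAt k z
    ... | inj₁ a = bound (a ↑ˡ (b + B))
    ... | inj₂ c = bound (k ↑ʳ (b ↑ʳ c))

liftφ : ∀ {n k} B → Var n k → Var n (k + B)
liftφ B (free x)  = free x
liftφ B (bound z) = bound (z ↑ˡ B)

replace : SH → List SH → Maybe SH
replace φ τs with replaceParts (calls φ) τs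
... | nothing = nothing
... | just (parts s c p) =
  just (mkSH (nfv φ) (nbv φ + sumB τs)
             (map (mapPointsTo (liftφ (sumB τs))) (spatial φ) ++ s)
             c
             (map (mapPure (liftφ (sumB τs))) (pure φ) ++ p))

record HeapAutomaton (C : SH → Set) : Set₁ where
  field
    nQ : ℕ
    Δ  : List (Fin nQ) → SH → Fin nQ → Set
    F  : Subset nQ
    Δ-class : ∀ {qs φ p} → Δ qs φ p → C φ
    Δ-dec   : ∀ qs φ → C φ → ∀ p → Dec (Δ qs φ p)
    Δ-arity : ∀ {qs φ p} → Δ qs φ p → length qs ≡ length (calls φ)
    compositional :
      ∀ (p : Fin nQ) (φ : SH) (τs : List SH) (ψ : SH) →
      C φ → All (λ τ → C τ × Reduced τ) τs →
      replace φ τs ≡ just ψ → C ψ →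
      (∃ λ (qs : List (Fin nQ)) →
          Δ qs φ p × Pointwise (λ τ q → Δ [] τ q) τs qs)
      ⇔ Δ [] ψ p

  L : SH → Set
  L τ = (Reduced τ × C τ) × ∃ λ q → q ∈ F × Δ [] τ q

open HeapAutomaton public

module Submission where

-- Both automata are determinised by the subset construction, run side by
-- side: a state is a subset S of Q𝔄 ⊎ Q𝔅, and φ leads from S₁ … S_m to the
-- set of all p with (q₁ … q_m, φ, p) ∈ Δ for some qᵢ ∈ Sᵢ.  Every reduced
-- heap τ then reaches exactly one subset, namely {p | (ε, τ, p) ∈ Δ}, and
-- compositionality of 𝔄 and 𝔅 transfers to the product because the τᵢ
-- plugged into φ can be represented by these canonical subsets.  Whether τ
-- lies in L(𝔄) or L(𝔅) is thus a decidable property of the subset τ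
-- reaches, so union, intersection and complement are obtained by choosing
-- the final subsets accordingly.

open import Defs
open import Data.Product using (Σ; _×_)
open import Data.Sum using (_⊎_)
open import Relation.Nullary using (¬_)
open import Function.Bundles using (_⇔_)

open import Data.Nat as ℕ using (ℕ; _^_)
open import Data.Fin using (Fin; zero; suc; _↑ˡ_; _↑ʳ_; splitAt; finToFun; funToFin)
open import Data.Fin.Properties using (any?; all?; splitAt-↑ˡ; splitAt-↑ʳ; finToFun-funToFin)
import Data.Fin.Properties as Fin
import Data.Fin.Subset as Subset
open import Data.Fin.Subset.Properties using (_∈?_)
open import Data.Vec using (tabulate)
open import Data.Vec.Properties using (lookup∘tabulate; []=⇒lookup; lookup⇒[]=)
open import Data.Bool.Properties using (T-≡)
open import Data.List using (List; []; _∷_; _++_; length; map)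
open import Data.List.Relation.Unary.All using (All; []; _∷_)
import Data.List.Relation.Unary.All as All
open import Data.List.Relation.Binary.Pointwise as Pointwise using (Pointwise; []; _∷_; Pointwise-length)
open import Data.Maybe using (just; nothing)
open import Data.Product using (∃; _,_; proj₁; proj₂)
open import Data.Product.Function.NonDependent.Propositional using (_×-⇔_)
open import Data.Sum using (inj₁; inj₂; [_,_]; [_,_]′)
open import Data.Sum.Function.Propositional using (_⊎-⇔_)
open import Data.Empty using (⊥-elim)
open import Relation.Nullary using (Dec; yes; no)
open import Relation.Nullary.Decidable using (map′; _×-dec_; _⊎-dec_; ¬?; isYes; toWitness; fromWitness)
open import Relation.Unary using (Decidable)
open import Relation.Binary.PropositionalEquality using (_≡_; refl; sym; trans; cong; cong₂; subst)
open import Function.Base using (_∘_)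
open import Function.Bundles using (mk⇔; Equivalence)
open import Function.Construct.Composition using (_⇔-∘_)
open import Function.Construct.Symmetry using (⇔-sym)
open Equivalence using (to; from)

replaceParts-reduced : ∀ {n k} (cs : List (Call (Var n k))) τs {r} →
  All Reduced τs → replaceParts cs τs ≡ just r →
  length τs ≡ length cs × Parts.pCalls r ≡ []
replaceParts-reduced [] [] [] refl = refl , refl
replaceParts-reduced (call P xs ∷ cs) (τ ∷ τs) (red ∷ reds) eq with nfv τ ℕ.≟ length xs
... | no _ with () ← eq
... | yes _ with replaceParts cs τs in eq′
...   | nothing with () ← eq
...   | just rest with refl ← eq =
  let lengths , callsRest = replaceParts-reduced cs τs reds eq′
  in cong ℕ.suc lengths , cong₂ _++_ (cong (map _) red) (cong (map _) callsRest)

replace-reduced : ∀ φ τs {ψ} → All Reduced τs → replace φ τs ≡ just ψ →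
  length τs ≡ length (calls φ) × Reduced ψ
replace-reduced φ τs reds eq with replaceParts (calls φ) τs in eq′
... | nothing with () ← eq
... | just (parts s c p) with refl ← eq = replaceParts-reduced (calls φ) τs reds eq′

_⇔?_ : ∀ {A B : Set} → Dec A → Dec B → Dec (A ⇔ B)
yes a ⇔? yes b = yes (mk⇔ (λ _ → b) (λ _ → a))
yes a ⇔? no ¬b = no λ a⇔b → ¬b (to a⇔b a)
no ¬a ⇔? yes b = no λ a⇔b → ¬a (from a⇔b b)
no ¬a ⇔? no ¬b = yes (mk⇔ (λ a → ⊥-elim (¬a a)) (λ b → ⊥-elim (¬b b)))

∃-Pointwise? : ∀ {n} {A : Set} {R : Fin n → A → Set} → (∀ q a → Dec (R q a)) →
  {P : List (Fin n) → Set} → Decidable P → ∀ as →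
  Dec (∃ λ qs → P qs × Pointwise R qs as)
∃-Pointwise? R? P? [] with P? []
... | yes p = yes ([] , p , [])
... | no ¬p = no λ { ([] , p , []) → ¬p p }
∃-Pointwise? R? P? (a ∷ as)
  with any? (λ q → R? q a ×-dec ∃-Pointwise? R? (λ qs → P? (q ∷ qs)) as)
... | yes (q , r , qs , p , rs) = yes (q ∷ qs , p , r ∷ rs)
... | no ¬found = no λ { (q ∷ qs , p , r ∷ rs) → ¬found (q , r , qs , p , rs) }

∈-tabulate-isYes : ∀ {n} {P : Fin n → Set} (P? : Decidable P) k →
  k Subset.∈ tabulate (λ i → isYes (P? i)) ⇔ P k
∈-tabulate-isYes P? k = mk⇔
  (λ k∈ → toWitness {a? = P? k} (from T-≡ (trans (sym (lookup∘tabulate _ k)) ([]=⇒lookup k∈))))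
  (λ p → lookup⇒[]= k _ (trans (lookup∘tabulate _ k) (to T-≡ (fromWitness {a? = P? k} p))))

_∋_ : ∀ {M} → Fin (2 ^ M) → Fin M → Set
_∋_ {M} k i = finToFun {2} {M} k i ≡ suc zero

_∋?_ : ∀ {M} (k : Fin (2 ^ M)) i → Dec (k ∋ i)
_∋?_ {M} k i = finToFun {2} {M} k i Fin.≟ suc zero

bit : ∀ {A : Set} → Dec A → Fin 2
bit (yes _) = suc zero
bit (no _)  = zero

bit≡1⇔ : ∀ {A : Set} (a? : Dec A) → bit a? ≡ suc zero ⇔ A
bit≡1⇔ (yes a) = mk⇔ (λ _ → a) (λ _ → refl)
bit≡1⇔ (no ¬a) = mk⇔ (λ ()) (λ a → ⊥-elim (¬a a))

encode : ∀ {M} {P : Fin M → Set} → Decidable P → Fin (2 ^ M)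
encode {M} P? = funToFin {M} {2} λ i → bit (P? i)

encode-∋ : ∀ {M} {P : Fin M → Set} (P? : Decidable P) i → encode P? ∋ i ⇔ P i
encode-∋ {M} P? i rewrite finToFun-funToFin {M} {2} (λ j → bit (P? j)) i = bit≡1⇔ (P? i)

module SubsetConstruction {C : SH → Set} (X : HeapAutomaton C) {N : ℕ}
  (_∈ₛ_ : Fin (nQ X) → Fin N → Set) (_∈ₛ?_ : ∀ p k → Dec (p ∈ₛ k)) where

  Runs : List (Fin N) → SH → Fin (nQ X) → Set
  Runs ks φ p = ∃ λ qs → Δ X qs φ p × Pointwise _∈ₛ_ qs ks

  Successor : List (Fin N) → SH → Fin N → Set
  Successor ks φ k = ∀ p → p ∈ₛ k ⇔ Runs ks φ p

  successor? : ∀ ks φ → C φ → ∀ k → Dec (Successor ks φ k)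
  successor? ks φ cφ k =
    all? λ p → (p ∈ₛ? k) ⇔? ∃-Pointwise? _∈ₛ?_ (λ qs → Δ-dec X qs φ cφ p) ks

  runs-[] : ∀ {τ p} → Runs [] τ p ⇔ Δ X [] τ p
  runs-[] = mk⇔ (λ { ([] , d , []) → d }) (λ d → [] , d , [])

  successor-[] : ∀ {τ k} → Successor [] τ k ⇔ (∀ p → p ∈ₛ k ⇔ Δ X [] τ p)
  successor-[] = mk⇔ (λ s p → runs-[] ⇔-∘ s p) (λ s p → ⇔-sym runs-[] ⇔-∘ s p)

  runs-through-successors : ∀ {τs ks φ p} → Pointwise (Successor []) τs ks →
    Runs ks φ p ⇔ (∃ λ qs → Δ X qs φ p × Pointwise (λ τ q → Δ X [] τ q) τs qs)
  runs-through-successors ss =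
    mk⇔ (λ { (qs , d , ms) → qs , d , members⇒runs ss ms })
        (λ { (qs , d , rs) → qs , d , runs⇒members ss rs })
    where
      members⇒runs : ∀ {τs ks qs} → Pointwise (Successor []) τs ks →
        Pointwise _∈ₛ_ qs ks → Pointwise (λ τ q → Δ X [] τ q) τs qs
      members⇒runs []       []       = []
      members⇒runs (s ∷ ss) (m ∷ ms) = to (to successor-[] s _) m ∷ members⇒runs ss ms

      runs⇒members : ∀ {τs ks qs} → Pointwise (Successor []) τs ks →
        Pointwise (λ τ q → Δ X [] τ q) τs qs → Pointwise _∈ₛ_ qs ks
      runs⇒members []       []       = []
      runs⇒members (s ∷ ss) (r ∷ rs) = from (to successor-[] s _) r ∷ runs⇒members ss rs

  successor-compositional : ∀ {φ τs ψ ks k} → C φ → All (λ τ → C τ × Reduced τ) τs →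
    replace φ τs ≡ just ψ → C ψ → Pointwise (Successor []) τs ks →
    Successor ks φ k ⇔ Successor [] ψ k
  successor-compositional {φ} {τs} {ψ} cφ cτs eq cψ ss = mk⇔
    (λ s → from successor-[] λ p → composed p ⇔-∘ s p)
    (λ s p → ⇔-sym (composed p) ⇔-∘ to successor-[] s p)
    where
      composed : ∀ p → Runs _ φ p ⇔ Δ X [] ψ p
      composed p = compositional X p φ τs ψ cφ cτs eq cψ ⇔-∘ runs-through-successors ss

module Combination {C : SH → Set} (𝔄 𝔅 : HeapAutomaton C) where

  nA nB : ℕ
  nA = nQ 𝔄
  nB = nQ 𝔅

  State : Set
  State = Fin (2 ^ (nA ℕ.+ nB))

  _∈ᴬ_ : Fin nA → State → Set
  p ∈ᴬ k = k ∋ (p ↑ˡ nB)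

  _∈ᴮ_ : Fin nB → State → Set
  p ∈ᴮ k = k ∋ (nA ↑ʳ p)

  module SA = SubsetConstruction 𝔄 _∈ᴬ_ (λ p k → k ∋? (p ↑ˡ nB))
  module SB = SubsetConstruction 𝔅 _∈ᴮ_ (λ p k → k ∋? (nA ↑ʳ p))

  Step : List State → SH → State → Set
  Step ks φ k =
    C φ × length ks ≡ length (calls φ) × SA.Successor ks φ k × SB.Successor ks φ k

  step? : ∀ ks φ → C φ → ∀ k → Dec (Step ks φ k)
  step? ks φ cφ k with length ks ℕ.≟ length (calls φ)
  ... | no ¬arity = no λ { (_ , arity , _) → ¬arity arity }
  ... | yes arity = map′ (λ (a , b) → cφ , arity , a , b) (λ (_ , _ , a , b) → a , b)
                         (SA.successor? ks φ cφ k ×-dec SB.successor? ks φ cφ k)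

  Reached : SH → Fin (nA ℕ.+ nB) → Set
  Reached τ i = [ Δ 𝔄 [] τ , Δ 𝔅 [] τ ]′ (splitAt nA i)

  reached? : ∀ τ → C τ → Decidable (Reached τ)
  reached? τ cτ i with splitAt nA i
  ... | inj₁ p = Δ-dec 𝔄 [] τ cτ p
  ... | inj₂ p = Δ-dec 𝔅 [] τ cτ p

  stateOf : ∀ τ → C τ → State
  stateOf τ cτ = encode (reached? τ cτ)

  stateOf-step : ∀ {τ} (cτ : C τ) → Reduced τ → Step [] τ (stateOf τ cτ)
  stateOf-step {τ} cτ red =
    cτ , sym (cong length red) , from SA.successor-[] reachedᴬ , from SB.successor-[] reachedᴮ
    where
      reachedᴬ : ∀ p → p ∈ᴬ stateOf τ cτ ⇔ Δ 𝔄 [] τ p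
      reachedᴬ p = subst (λ x → p ∈ᴬ stateOf τ cτ ⇔ [ Δ 𝔄 [] τ , Δ 𝔅 [] τ ]′ x)
                         (splitAt-↑ˡ nA p nB) (encode-∋ (reached? τ cτ) (p ↑ˡ nB))

      reachedᴮ : ∀ p → p ∈ᴮ stateOf τ cτ ⇔ Δ 𝔅 [] τ p
      reachedᴮ p = subst (λ x → p ∈ᴮ stateOf τ cτ ⇔ [ Δ 𝔄 [] τ , Δ 𝔅 [] τ ]′ x)
                         (splitAt-↑ʳ nA nB p) (encode-∋ (reached? τ cτ) (nA ↑ʳ p))

  reachedStates : ∀ {τs} → All (λ τ → C τ × Reduced τ) τs →
    ∃ λ ks → Pointwise (λ τ k → Step [] τ k) τs ks
  reachedStates [] = [] , []
  reachedStates ((cτ , red) ∷ cτs) =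
    let ks , steps = reachedStates cτs in stateOf _ cτ ∷ ks , stateOf-step cτ red ∷ steps

  step-compositional : ∀ p φ τs ψ → C φ → All (λ τ → C τ × Reduced τ) τs →
    replace φ τs ≡ just ψ → C ψ →
    (∃ λ ks → Step ks φ p × Pointwise (λ τ k → Step [] τ k) τs ks) ⇔ Step [] ψ p
  step-compositional p φ τs ψ cφ cτs eq cψ = mk⇔
    (λ { (_ , (_ , _ , a , b) , steps) →
           cψ , sym (cong length reducedψ) ,
           to (successorsᴬ steps) a , to (successorsᴮ steps) b })
    (λ { (_ , _ , a , b) →
           let ks , steps = reachedStates cτs in
           ks , (cφ , trans (sym (Pointwise-length steps)) arity ,
                  from (successorsᴬ steps) a , from (successorsᴮ steps) b) , steps })
    where
      arity : length τs ≡ length (calls φ)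
      arity = proj₁ (replace-reduced φ τs (All.map proj₂ cτs) eq)

      reducedψ : Reduced ψ
      reducedψ = proj₂ (replace-reduced φ τs (All.map proj₂ cτs) eq)

      successorsᴬ : ∀ {ks} → Pointwise (λ τ k → Step [] τ k) τs ks →
        SA.Successor ks φ p ⇔ SA.Successor [] ψ p
      successorsᴬ steps = SA.successor-compositional cφ cτs eq cψ
        (Pointwise.map (λ (_ , _ , a , _) → a) steps)

      successorsᴮ : ∀ {ks} → Pointwise (λ τ k → Step [] τ k) τs ks →
        SB.Successor ks φ p ⇔ SB.Successor [] ψ p
      successorsᴮ steps = SB.successor-compositional cφ cτs eq cψ
        (Pointwise.map (λ (_ , _ , _ , b) → b) steps)

  combination : {Acc : State → Set} → Decidable Acc → HeapAutomaton C
  combination acc? = record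
    { nQ            = 2 ^ (nA ℕ.+ nB)
    ; Δ             = Step
    ; F             = tabulate (λ k → isYes (acc? k))
    ; Δ-class       = proj₁
    ; Δ-dec         = step?
    ; Δ-arity       = λ s → proj₁ (proj₂ s)
    ; compositional = step-compositional
    }

  L-combination : ∀ {Acc : State → Set} (acc? : Decidable Acc) {Φ : SH → Set} →
    (∀ {τ} → Φ τ → Reduced τ × C τ) →
    (∀ {τ k} → Reduced τ × C τ → Step [] τ k → Acc k ⇔ Φ τ) →
    ∀ τ → L (combination acc?) τ ⇔ Φ τ
  L-combination acc? Φ⇒rc acc⇔Φ τ = mk⇔
    (λ { (rc , k , k∈F , step) → to (acc⇔Φ rc step) (to (∈-tabulate-isYes acc? k) k∈F) })
    (λ Φτ → let rc@(red , cτ) = Φ⇒rc Φτ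
                step = stateOf-step cτ red
            in rc , stateOf τ cτ , from (∈-tabulate-isYes acc? _) (from (acc⇔Φ rc step) Φτ) , step)

  Acceptsᴬ : State → Set
  Acceptsᴬ k = ∃ λ p → p ∈ᴬ k × p Subset.∈ F 𝔄

  Acceptsᴮ : State → Set
  Acceptsᴮ k = ∃ λ p → p ∈ᴮ k × p Subset.∈ F 𝔅

  acceptsᴬ? : Decidable Acceptsᴬ
  acceptsᴬ? k = any? λ p → k ∋? (p ↑ˡ nB) ×-dec p ∈? F 𝔄

  acceptsᴮ? : Decidable Acceptsᴮ
  acceptsᴮ? k = any? λ p → k ∋? (nA ↑ʳ p) ×-dec p ∈? F 𝔅

  acceptsᴬ⇔L : ∀ {τ k} → Reduced τ × C τ → Step [] τ k → Acceptsᴬ k ⇔ L 𝔄 τ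
  acceptsᴬ⇔L rc (_ , _ , a , _) = mk⇔
    (λ (p , p∈k , p∈F) → rc , p , p∈F , to (to SA.successor-[] a p) p∈k)
    (λ (_ , p , p∈F , run) → p , from (to SA.successor-[] a p) run , p∈F)

  acceptsᴮ⇔L : ∀ {τ k} → Reduced τ × C τ → Step [] τ k → Acceptsᴮ k ⇔ L 𝔅 τ
  acceptsᴮ⇔L rc (_ , _ , _ , b) = mk⇔
    (λ (p , p∈k , p∈F) → rc , p , p∈F , to (to SB.successor-[] b p) p∈k)
    (λ (_ , p , p∈F , run) → p , from (to SB.successor-[] b p) run , p∈F)

mainTheorem3 : (C : SH → Set) (𝔄 𝔅 : HeapAutomaton C) →
    Σ (HeapAutomaton C) (λ ℭ₁ → ∀ τ → L ℭ₁ τ ⇔ (L 𝔄 τ ⊎ L 𝔅 τ))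
    × Σ (HeapAutomaton C) (λ ℭ₂ → ∀ τ → L ℭ₂ τ ⇔ (L 𝔄 τ × L 𝔅 τ))
    × Σ (HeapAutomaton C) (λ ℭ₃ → ∀ τ → L ℭ₃ τ ⇔ ((Reduced τ × C τ) × ¬ L 𝔄 τ))
mainTheorem3 C 𝔄 𝔅 =
    (combination union? ,
     L-combination union? [ proj₁ , proj₁ ]
       (λ rc step → acceptsᴬ⇔L rc step ⊎-⇔ acceptsᴮ⇔L rc step))
  , (combination intersection? ,
     L-combination intersection? (proj₁ ∘ proj₁)
       (λ rc step → acceptsᴬ⇔L rc step ×-⇔ acceptsᴮ⇔L rc step))
  , (combination complement? ,
     L-combination complement? proj₁
       (λ rc step → let a⇔L = acceptsᴬ⇔L rc step in
         mk⇔ (λ ¬a → rc , ¬a ∘ from a⇔L) (λ (_ , ¬l) → ¬l ∘ to a⇔L)))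
  where
    open Combination 𝔄 𝔅

    union? : Decidable (λ k → Acceptsᴬ k ⊎ Acceptsᴮ k)
    union? k = acceptsᴬ? k ⊎-dec acceptsᴮ? k

    intersection? : Decidable (λ k → Acceptsᴬ k × Acceptsᴮ k)
    intersection? k = acceptsᴬ? k ×-dec acceptsᴮ? k

    complement? : Decidable (λ k → ¬ Acceptsᴬ k)
    complement? k = ¬? (acceptsᴬ? k)
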